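{- Let $M$ be an internally $4$-connected matroid having at least ten elements. Suppose that $M$ has $T_0,D_0,T_1,D_1,\dots,T_n$ as a string of bowties, where $T_i=\{a_i,b_i,c_i\}$, $D_j=\{b_j,c_j,a_{j+1},b_{j+1}\}$, and $T_0$ and $T_n$ are disjoint. Assume that $(T_n,T_{n+1},D)$ is a bowtie of $M$, where $T_{n+1}=\{a_{n+1},b_{n+1},c_{n+1}\}$ and $D\neq D_{n-1}$ is a $4$-cocircuit with $\{c_n,a_{n+1},b_{n+1}\}\subseteq D$. If $T_{n+1}$ meets $T_i$ for some $i\le n$, then either (i) $T_{n+1}=T_j$ for some $j$ with $0\le j\le n-2$; or (ii) $T_{n+1}\cap(T_0\cup T_1\cup\cdots\cup T_n)=T_{n+1}\cap T_0=\{a_0\}=\{c_{n+1}\}$. Furthermore, if $\{x,c_n,a_0,b_0\}$ is a cocircuit of $M$ for some $x\in\{a_n,b_n\}$, then (i) holds.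
   Context: A triangle is a $3$-element circuit, a triad a $3$-element cocircuit; $M$ is internally $4$-connected if it is $3$-connected and for every $3$-separation $(X,Y)$ one of $X,Y$ is a triangle or a triad. A bowtie $(T_1,T_2,D^*)$ consists of two disjoint triangles and a $4$-cocircuit $D^*\subseteq T_1\cup T_2$. A string of bowties $T_0,D_0,\dots,T_n$ ($n\ge1$) consists of elements $a_i,b_i,c_i$, all distinct except that $a_0$ and $c_n$ may be equal, such that each $T_i=\{a_i,b_i,c_i\}$ is a triangle and each $D_j=\{b_j,c_j,a_{j+1},b_{j+1}\}$ is a cocircuit. -}

module Defs where

open import Data.Nat using (ℕ; zero; suc; _+_; _≤_; _<_)
open import Data.Fin using (Fin)
open import Data.Fin.Subset using (Subset; ⊤; ⊥; ⁅_⁆; _∈_; _∉_; _⊆_; _⊂_; ∁; _∪_; _∩_; ∣_∣)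
open import Data.Product using (Σ; ∃; _×_; _,_)
open import Data.Sum using (_⊎_)
open import Relation.Nullary using (¬_)
open import Relation.Binary.PropositionalEquality using (_≡_)

record Matroid (m : ℕ) : Set₁ where
  field
    Indep       : Subset m → Set
    indep-empty : Indep ⊥
    indep-sub   : ∀ X Y → X ⊆ Y → Indep Y → Indep X
    augment     : ∀ X Y → Indep X → Indep Y → ∣ X ∣ < ∣ Y ∣ →
                  ∃ λ e → e ∈ Y × e ∉ X × Indep (X ∪ ⁅ e ⁆)
open Matroid public

module _ {m : ℕ} where

  CircuitOf : (Subset m → Set) → Subset m → Set
  CircuitOf I C = ¬ I C × (∀ Y → Y ⊂ C → I Y)

  Basis : Matroid m → Subset m → Set
  Basis M B = Indep M B × (∀ Y → B ⊂ Y → ¬ Indep M Y)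

  IndepDual : Matroid m → Subset m → Set
  IndepDual M X = ∃ λ B → Basis M B × X ⊆ ∁ B

  Circuit : Matroid m → Subset m → Set
  Circuit M = CircuitOf (Indep M)

  Cocircuit : Matroid m → Subset m → Set
  Cocircuit M = CircuitOf (IndepDual M)

  Triangle : Matroid m → Subset m → Set
  Triangle M X = Circuit M X × ∣ X ∣ ≡ 3

  Triad : Matroid m → Subset m → Set
  Triad M X = Cocircuit M X × ∣ X ∣ ≡ 3

  IsRank : Matroid m → Subset m → ℕ → Set
  IsRank M X k = (∃ λ J → J ⊆ X × Indep M J × ∣ J ∣ ≡ k)
               × (∀ J → J ⊆ X → Indep M J → ∣ J ∣ ≤ k)

  Separation : Matroid m → ℕ → Subset m → Set
  Separation M k X = k ≤ ∣ X ∣ × k ≤ ∣ ∁ X ∣ ×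
    ∃ λ rX → ∃ λ rY → ∃ λ rE →
      IsRank M X rX × IsRank M (∁ X) rY × IsRank M ⊤ rE × rX + rY < rE + k

  ThreeConnected : Matroid m → Set
  ThreeConnected M = ∀ X → ¬ Separation M 1 X × ¬ Separation M 2 X

  TriangleOrTriad : Matroid m → Subset m → Set
  TriangleOrTriad M X = Triangle M X ⊎ Triad M X

  InternallyFourConnected : Matroid m → Set
  InternallyFourConnected M = ThreeConnected M ×
    (∀ X → Separation M 3 X → TriangleOrTriad M X ⊎ TriangleOrTriad M (∁ X))

  set3 : Fin m → Fin m → Fin m → Subset m
  set3 x y z = ⁅ x ⁆ ∪ ⁅ y ⁆ ∪ ⁅ z ⁆

  set4 : Fin m → Fin m → Fin m → Fin m → Subset m
  set4 w x y z = ⁅ w ⁆ ∪ ⁅ x ⁆ ∪ ⁅ y ⁆ ∪ ⁅ z ⁆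

  Tri : (a b c : ℕ → Fin m) → ℕ → Subset m
  Tri a b c i = set3 (a i) (b i) (c i)

  Dco : (a b c : ℕ → Fin m) → ℕ → Subset m
  Dco a b c j = set4 (b j) (c j) (a (suc j)) (b (suc j))

  TriUpTo : (a b c : ℕ → Fin m) → ℕ → Subset m
  TriUpTo a b c zero = Tri a b c zero
  TriUpTo a b c (suc k) = TriUpTo a b c k ∪ Tri a b c (suc k)

  Disjoint : Subset m → Subset m → Set
  Disjoint X Y = X ∩ Y ≡ ⊥

  StringOfBowties : Matroid m → (a b c : ℕ → Fin m) → ℕ → Set
  StringOfBowties M a b c n =
    1 ≤ n ×
    -- all a_i,b_i,c_i (i ≤ n) distinct, except possibly a_0 = c_n
    (∀ i j → i ≤ n → j ≤ n →
        (a i ≡ a j → i ≡ j) × (b i ≡ b j → i ≡ j) × (c i ≡ c j → i ≡ j) ×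
        ¬ (a i ≡ b j) × ¬ (b i ≡ c j) × (a i ≡ c j → i ≡ 0 × j ≡ n)) ×
    (∀ i → i ≤ n → Triangle M (Tri a b c i)) ×
    (∀ j → j < n → Cocircuit M (Dco a b c j))

  Bowtie : Matroid m → Subset m → Subset m → Subset m → Set
  Bowtie M T T' D = Triangle M T × Triangle M T' × Disjoint T T' ×
    Cocircuit M D × ∣ D ∣ ≡ 4 × D ⊆ (T ∪ T')

-- Orthogonality between the triangles and cocircuits of the string pins Tₙ₊₁ down.  Two distinct
-- triangles of an internally 4-connected matroid share at most one element, so if Tₙ₊₁ is none of
-- T₀, …, Tₙ then aₙ₊₁, bₙ₊₁ ∈ D lie on no Tᵢ (else D would meet Tᵢ in one element).  Hence Tₙ₊₁ meets
-- the string only in cₙ₊₁; as cₙ₊₁ avoids every Dⱼ, it must be a₀, and a cocircuit {x, cₙ, a₀, b₀}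
-- would meet Tₙ₊₁ in a₀ alone.  Finally Tₙ₊₁ is neither Tₙ (disjoint) nor Tₙ₋₁: then D ≠ Dₙ₋₁
-- would be two cocircuits inside Tₙ₋₁ ∪ Tₙ, forcing a 3-separation with both sides of size ≥ 4.

module Submission where

open import Defs
open import Data.Bool.Properties using () renaming (_≟_ to _≟ᵇ_)
open import Data.Empty using (⊥; ⊥-elim)
open import Data.Fin using (Fin; zero; suc) renaming (_≟_ to _≟ᶠ_)
open import Data.Fin.Subset
  using (Subset; ⁅_⁆; _∈_; _∉_; _⊆_; _⊂_; _∩_; _∪_; _-_; ∁; ∣_∣; ⊤; Nonempty; inside; outside)
  renaming (⊥ to ∅)
open import Data.Fin.Subset.Properties
  using ( _∈?_; ∈⊤; ∉⊥; ⊥⊆; ⊆-antisym; ⊆-trans; ∣p∣≤n; ∣⁅x⁆∣≡1; ∣∁p∣≡n∸∣p∣; ∪-identityʳ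
        ; p⊆q⇒∣p∣≤∣q∣; p⊂q⇒∣p∣<∣q∣; p⊆p∪q; q⊆p∪q; p─q⊆p; x∈p∪q⁻; x∈p∩q⁻; x∈p∩q⁺; x∈⁅x⁆; x∈⁅y⁆⇒x≡y
        ; x≢y⇒x∉⁅y⁆; x∈∁p⇒x∉p; x∉p⇒x∈∁p; x∈p⇒p-x⊂p; x∈p∧x≢y⇒x∈p-y )
open import Data.Nat using (ℕ; zero; suc; _+_; _∸_; _≤_; _<_; _≤?_; z≤n; s≤s; anyUpTo?)
open import Data.Nat.Properties
open import Data.Product using (∃; _×_; _,_; proj₁; proj₂)
open import Data.Sum using (_⊎_; inj₁; inj₂; [_,_]′)
open import Data.Vec using ([]; _∷_; here; there)
open import Data.Vec.Properties using (≡-dec)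
open import Function using (_∘_)
open import Relation.Nullary using (¬_; yes; no)
open import Relation.Binary.PropositionalEquality using (_≡_; _≢_; refl; sym; trans; subst; cong; cong₂)

private variable
  k : ℕ
  p q : Subset k
  x y : Fin k

∣p∪q∣≤∣p∣+∣q∣ : (p q : Subset k) → ∣ p ∪ q ∣ ≤ ∣ p ∣ + ∣ q ∣
∣p∪q∣≤∣p∣+∣q∣ []            []            = z≤n
∣p∪q∣≤∣p∣+∣q∣ (inside ∷ p)  (inside ∷ q)  = s≤s (≤-trans (∣p∪q∣≤∣p∣+∣q∣ p q) (+-monoʳ-≤ ∣ p ∣ (n≤1+n _)))
∣p∪q∣≤∣p∣+∣q∣ (inside ∷ p)  (outside ∷ q) = s≤s (∣p∪q∣≤∣p∣+∣q∣ p q)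
∣p∪q∣≤∣p∣+∣q∣ (outside ∷ p) (inside ∷ q)  =
  ≤-trans (s≤s (∣p∪q∣≤∣p∣+∣q∣ p q)) (≤-reflexive (sym (+-suc ∣ p ∣ ∣ q ∣)))
∣p∪q∣≤∣p∣+∣q∣ (outside ∷ p) (outside ∷ q) = ∣p∪q∣≤∣p∣+∣q∣ p q

x∉p⇒∣p∪⁅x⁆∣≡1+∣p∣ : (p : Subset k) → x ∉ p → ∣ p ∪ ⁅ x ⁆ ∣ ≡ suc ∣ p ∣
x∉p⇒∣p∪⁅x⁆∣≡1+∣p∣ {x = zero}  (inside ∷ p)  x∉p = ⊥-elim (x∉p here)
x∉p⇒∣p∪⁅x⁆∣≡1+∣p∣ {x = zero}  (outside ∷ p) _   = cong (suc ∘ ∣_∣) (∪-identityʳ p)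
x∉p⇒∣p∪⁅x⁆∣≡1+∣p∣ {x = suc x} (inside ∷ p)  x∉p = cong suc (x∉p⇒∣p∪⁅x⁆∣≡1+∣p∣ p (x∉p ∘ there))
x∉p⇒∣p∪⁅x⁆∣≡1+∣p∣ {x = suc x} (outside ∷ p) x∉p = x∉p⇒∣p∪⁅x⁆∣≡1+∣p∣ p (x∉p ∘ there)

x∉p-x : (p : Subset k) → x ∉ p - x
x∉p-x {x = zero}  (_ ∷ p) ()
x∉p-x {x = suc x} (_ ∷ p) (there x∈p-x) = x∉p-x p x∈p-x

x∈p-y⇒x≢y : x ∈ p - y → x ≢ y
x∈p-y⇒x≢y {p = p} x∈p-x refl = x∉p-x p x∈p-x

x∉p⇒p⊂p∪⁅x⁆ : x ∉ p → p ⊂ p ∪ ⁅ x ⁆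
x∉p⇒p⊂p∪⁅x⁆ {x = x} {p = p} x∉p = p⊆p∪q ⁅ x ⁆ , x , q⊆p∪q p ⁅ x ⁆ (x∈⁅x⁆ x) , x∉p

x∈p⇒⁅x⁆⊆p : x ∈ p → ⁅ x ⁆ ⊆ p
x∈p⇒⁅x⁆⊆p {p = p} x∈p y∈⁅x⁆ = subst (_∈ p) (sym (x∈⁅y⁆⇒x≡y _ y∈⁅x⁆)) x∈p

p⊆q∧x∈q⇒p∪⁅x⁆⊆q : p ⊆ q → x ∈ q → p ∪ ⁅ x ⁆ ⊆ q
p⊆q∧x∈q⇒p∪⁅x⁆⊆q p⊆q x∈q y∈p∪⁅x⁆ = [ p⊆q , x∈p⇒⁅x⁆⊆p x∈q ]′ (x∈p∪q⁻ _ _ y∈p∪⁅x⁆)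

⊆-or-∃∉ : (p q : Subset k) → p ⊆ q ⊎ ∃ λ x → x ∈ p × x ∉ q
⊆-or-∃∉ []      []      = inj₁ λ ()
⊆-or-∃∉ (s ∷ p) (t ∷ q) with ⊆-or-∃∉ p q
... | inj₂ (x , x∈p , x∉q) = inj₂ (suc x , there x∈p , λ { (there x∈q) → x∉q x∈q })
⊆-or-∃∉ (inside ∷ p)  (inside ∷ q)  | inj₁ p⊆q = inj₁ λ { here → here ; (there x∈p) → there (p⊆q x∈p) }
⊆-or-∃∉ (inside ∷ p)  (outside ∷ q) | inj₁ _   = inj₂ (zero , here , λ ())
⊆-or-∃∉ (outside ∷ p) (_ ∷ q)       | inj₁ p⊆q = inj₁ λ { (there x∈p) → there (p⊆q x∈p) }

p⊆q∧∣q∣≤∣p∣⇒q⊆p : p ⊆ q → ∣ q ∣ ≤ ∣ p ∣ → q ⊆ p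
p⊆q∧∣q∣≤∣p∣⇒q⊆p {p = p} p⊆q ∣q∣≤∣p∣ {x} x∈q with x ∈? p
... | yes x∈p = x∈p
... | no  x∉p = ⊥-elim (<⇒≱ (p⊂q⇒∣p∣<∣q∣ (p⊆q , x , x∈q , x∉p)) ∣q∣≤∣p∣)

∈set3⁻ : {w x y z : Fin k} → w ∈ set3 x y z → w ≡ x ⊎ w ≡ y ⊎ w ≡ z
∈set3⁻ w∈ with x∈p∪q⁻ _ _ w∈
... | inj₁ w∈⁅x⁆ = inj₁ (x∈⁅y⁆⇒x≡y _ w∈⁅x⁆)
... | inj₂ w∈yz with x∈p∪q⁻ _ _ w∈yz
... | inj₁ w∈⁅y⁆ = inj₂ (inj₁ (x∈⁅y⁆⇒x≡y _ w∈⁅y⁆))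
... | inj₂ w∈⁅z⁆ = inj₂ (inj₂ (x∈⁅y⁆⇒x≡y _ w∈⁅z⁆))

set3∋₁ : {x y z : Fin k} → x ∈ set3 x y z
set3∋₁ = p⊆p∪q _ (x∈⁅x⁆ _)

set3∋₂ : {x y z : Fin k} → y ∈ set3 x y z
set3∋₂ = q⊆p∪q _ _ (p⊆p∪q _ (x∈⁅x⁆ _))

set3∋₃ : {x y z : Fin k} → z ∈ set3 x y z
set3∋₃ = q⊆p∪q _ _ (q⊆p∪q _ _ (x∈⁅x⁆ _))

∈set4⁻ : {v w x y z : Fin k} → v ∈ set4 w x y z → v ≡ w ⊎ v ≡ x ⊎ v ≡ y ⊎ v ≡ z
∈set4⁻ v∈ = [ inj₁ ∘ x∈⁅y⁆⇒x≡y _ , inj₂ ∘ ∈set3⁻ ]′ (x∈p∪q⁻ _ _ v∈)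

set4∋₁ : {w x y z : Fin k} → w ∈ set4 w x y z
set4∋₁ = p⊆p∪q _ (x∈⁅x⁆ _)

set4∋₂ : {w x y z : Fin k} → x ∈ set4 w x y z
set4∋₂ = q⊆p∪q _ _ set3∋₁

set4∋₃ : {w x y z : Fin k} → y ∈ set4 w x y z
set4∋₃ = q⊆p∪q _ _ set3∋₂

Disjoint⇒∉ : Disjoint p q → x ∈ p → x ∉ q
Disjoint⇒∉ {x = x} p∩q≡∅ x∈p x∈q = ∉⊥ (subst (x ∈_) p∩q≡∅ (x∈p∩q⁺ (x∈p , x∈q)))

module _ {m : ℕ} where

  private variable
    C S : Subset m
    I : Subset m → Set

  CircuitOf-⊆⇒≡ : {C₁ C₂ : Subset m} → CircuitOf I C₁ → CircuitOf I C₂ → C₁ ⊆ C₂ → C₁ ≡ C₂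
  CircuitOf-⊆⇒≡ {C₁ = C₁} {C₂} (dep₁ , _) (_ , min₂) C₁⊆C₂ with ⊆-or-∃∉ C₂ C₁
  ... | inj₁ C₂⊆C₁              = ⊆-antisym C₁⊆C₂ C₂⊆C₁
  ... | inj₂ (x , x∈C₂ , x∉C₁) = ⊥-elim (dep₁ (min₂ C₁ (C₁⊆C₂ , x , x∈C₂ , x∉C₁)))

  CircuitOf-⊂-indep : CircuitOf I C → S ⊆ C → ∣ S ∣ < ∣ C ∣ → I S
  CircuitOf-⊂-indep {C = C} {S} (_ , min) S⊆C ∣S∣<∣C∣ with ⊆-or-∃∉ C S
  ... | inj₁ C⊆S             = ⊥-elim (<⇒≱ ∣S∣<∣C∣ (p⊆q⇒∣p∣≤∣q∣ C⊆S))
  ... | inj₂ (x , x∈C , x∉S) = min S (S⊆C , x , x∈C , x∉S)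

module MatroidProperties {m : ℕ} (M : Matroid m) where

  private variable
    B C C* I J K S X Z : Subset m
    r : ℕ
    e : Fin m

  circuit-⊆-dep : Circuit M C → S ⊆ C → ∣ C ∣ ≤ ∣ S ∣ → ¬ Indep M S
  circuit-⊆-dep {C} {S} (dep , _) S⊆C ∣C∣≤∣S∣ indS =
    dep (indep-sub M C S (p⊆q∧∣q∣≤∣p∣⇒q⊆p S⊆C ∣C∣≤∣S∣) indS)

  indep-∩-triangle-≤2 : Triangle M C → Indep M J → ∣ J ∩ C ∣ ≤ 2
  indep-∩-triangle-≤2 {C} {J} (circuit , ∣C∣≡3) indJ with ∣ J ∩ C ∣ ≤? 2
  ... | yes ok = ok
  ... | no ∣J∩C∣≥3 = ⊥-elim (circuit-⊆-dep circuit (λ x∈ → proj₂ (x∈p∩q⁻ J C x∈))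
          (subst (_≤ ∣ J ∩ C ∣) (sym ∣C∣≡3) (≰⇒> ∣J∩C∣≥3))
          (indep-sub M (J ∩ C) J (λ x∈ → proj₁ (x∈p∩q⁻ J C x∈)) indJ))

  indep-≥-basis-is-basis : Basis M B → Indep M Z → ∣ B ∣ ≤ ∣ Z ∣ → Basis M Z
  indep-≥-basis-is-basis {B} {Z} (indB , maxB) indZ ∣B∣≤∣Z∣ = indZ , λ Y Z⊂Y indY →
    let e , _ , e∉B , indBe = augment M B Y indB indY (<-≤-trans (s≤s ∣B∣≤∣Z∣) (p⊂q⇒∣p∣<∣q∣ Z⊂Y))
    in maxB (B ∪ ⁅ e ⁆) (x∉p⇒p⊂p∪⁅x⁆ e∉B) indBe

  rank-sized-indep-is-basis : IsRank M ⊤ r → Indep M Z → r ≤ ∣ Z ∣ → Basis M Z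
  rank-sized-indep-is-basis (_ , maximal) indZ r≤∣Z∣ = indZ , λ Y Z⊂Y indY →
    <⇒≱ (p⊂q⇒∣p∣<∣q∣ Z⊂Y) (≤-trans (maximal Y (λ _ → ∈⊤) indY) r≤∣Z∣)

  basis-size≥rank : IsRank M ⊤ r → Basis M B → r ≤ ∣ B ∣
  basis-size≥rank {B = B} ((J , _ , indJ , refl) , _) (indB , maxB) with ∣ J ∣ ≤? ∣ B ∣
  ... | yes ∣J∣≤∣B∣ = ∣J∣≤∣B∣
  ... | no  ∣J∣≰∣B∣ =
    let e , _ , e∉B , indBe = augment M B J indB indJ (≰⇒> ∣J∣≰∣B∣)
    in ⊥-elim (maxB (B ∪ ⁅ e ⁆) (x∉p⇒p⊂p∪⁅x⁆ e∉B) indBe)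

  cocircuit-meets-basis : Cocircuit M C → Basis M B → ¬ (∀ {x} → x ∈ C → x ∉ B)
  cocircuit-meets-basis (codep , _) basisB C∩B≡∅ = codep (_ , basisB , x∉p⇒x∈∁p ∘ C∩B≡∅)

  augment-from : Indep M I → Indep M K → ∃ λ Z → I ⊆ Z × Z ⊆ I ∪ K × Indep M Z × ∣ K ∣ ≤ ∣ Z ∣
  augment-from {I} {K} indI indK = grow ∣ K ∣ I (λ x∈I → x∈I) (p⊆p∪q K) indI (m≤n+m ∣ K ∣ ∣ I ∣)
    where
    grow : ∀ fuel J → I ⊆ J → J ⊆ I ∪ K → Indep M J → ∣ K ∣ ≤ ∣ J ∣ + fuel →
           ∃ λ Z → I ⊆ Z × Z ⊆ I ∪ K × Indep M Z × ∣ K ∣ ≤ ∣ Z ∣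
    grow fuel J I⊆J J⊆I∪K indJ bound with ∣ K ∣ ≤? ∣ J ∣
    ... | yes ∣K∣≤∣J∣ = J , I⊆J , J⊆I∪K , indJ , ∣K∣≤∣J∣
    grow zero J _ _ _ bound | no ∣K∣≰∣J∣ = ⊥-elim (∣K∣≰∣J∣ (subst (_ ≤_) (+-identityʳ _) bound))
    grow (suc fuel) J I⊆J J⊆I∪K indJ bound | no ∣K∣≰∣J∣ =
      let e , e∈K , e∉J , indJe = augment M J K indJ indK (≰⇒> ∣K∣≰∣J∣)
      in grow fuel (J ∪ ⁅ e ⁆) (⊆-trans I⊆J (p⊆p∪q ⁅ e ⁆))
           (p⊆q∧x∈q⇒p∪⁅x⁆⊆q J⊆I∪K (q⊆p∪q I K e∈K)) indJe
           (subst (λ s → ∣ K ∣ ≤ s + fuel) (sym (x∉p⇒∣p∪⁅x⁆∣≡1+∣p∣ J e∉J))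
             (subst (∣ K ∣ ≤_) (+-suc ∣ J ∣ fuel) bound))

  -- Extend C − e to a basis Z using a basis avoiding C* − e: either C ⊆ Z or Z avoids C*.
  orthogonality : Circuit M C → Cocircuit M C* → e ∈ C → e ∈ C* →
                  (∀ {z} → z ∈ C → z ∈ C* → z ≡ e) → ⊥
  orthogonality {C} {C*} {e} (dep , minC) co*@(_ , minC*) e∈C e∈C* only
    with minC* (C* - e) (x∈p⇒p-x⊂p e∈C*)
  ... | B , basisB , C*-e⊆∁B with augment-from (minC (C - e) (x∈p⇒p-x⊂p e∈C)) (proj₁ basisB)
  ... | Z , C-e⊆Z , Z⊆ , indZ , ∣B∣≤∣Z∣ with e ∈? Z
  ... | yes e∈Z = dep (indep-sub M C Z C⊆Z indZ)
    where
    C⊆Z : C ⊆ Z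
    C⊆Z {x} x∈C with x ≟ᶠ e
    ... | yes refl = e∈Z
    ... | no  x≢e  = C-e⊆Z (x∈p∧x≢y⇒x∈p-y x∈C x≢e)
  ... | no e∉Z = cocircuit-meets-basis co* (indep-≥-basis-is-basis basisB indZ ∣B∣≤∣Z∣) C*∩Z≡∅
    where
    C*∩Z≡∅ : ∀ {x} → x ∈ C* → x ∉ Z
    C*∩Z≡∅ {x} x∈C* x∈Z with x∈p∪q⁻ _ _ (Z⊆ x∈Z)
    ... | inj₁ x∈C-e = x∈p-y⇒x≢y x∈C-e (only (p─q⊆p C ⁅ e ⁆ x∈C-e) x∈C*)
    ... | inj₂ x∈B with x ≟ᶠ e
    ... | yes refl = e∉Z x∈Z
    ... | no  x≢e  = x∈∁p⇒x∉p (C*-e⊆∁B (x∈p∧x≢y⇒x∈p-y x∈C* x≢e)) x∈B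

  -- Ranks exist only under double negation, as independence is not decidable; all uses aim at ⊥.
  rank-exists : (X : Subset m) → ¬ ¬ ∃ (IsRank M X)
  rank-exists X = grow m ∅ ⊥⊆ (indep-empty M) (m≤n+m m ∣ ∅ {m} ∣)
    where
    grow : ∀ fuel J → J ⊆ X → Indep M J → m ≤ ∣ J ∣ + fuel → ¬ ¬ ∃ (IsRank M X)
    grow zero J J⊆X indJ bound no-rank = no-rank (∣ J ∣ , (J , J⊆X , indJ , refl) ,
      λ J′ _ _ → ≤-trans (∣p∣≤n J′) (subst (m ≤_) (+-identityʳ _) bound))
    grow (suc fuel) J J⊆X indJ bound no-rank = no-rank (∣ J ∣ , (J , J⊆X , indJ , refl) , maximal)
      where
      maximal : ∀ J′ → J′ ⊆ X → Indep M J′ → ∣ J′ ∣ ≤ ∣ J ∣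
      maximal J′ J′⊆X indJ′ with ∣ J′ ∣ ≤? ∣ J ∣
      ... | yes ∣J′∣≤∣J∣ = ∣J′∣≤∣J∣
      ... | no  ∣J′∣≰∣J∣ = ⊥-elim (grow fuel J′ J′⊆X indJ′
            (≤-trans bound (≤-trans (≤-reflexive (+-suc ∣ J ∣ fuel)) (+-monoˡ-≤ fuel (≰⇒> ∣J′∣≰∣J∣))))
            no-rank)

  ThreeSeparating : Subset m → Set
  ThreeSeparating X = ∀ {rX rY rE} → IsRank M X rX → IsRank M (∁ X) rY → IsRank M ⊤ rE → rX + rY < rE + 3

  ThreeSeparating-from-bounds : ∀ s t → s < t + 3 →
    (∀ J → J ⊆ X → Indep M J → ∣ J ∣ ≤ s) →
    (∀ {r} → IsRank M ⊤ r → ∀ J → J ⊆ ∁ X → Indep M J → ∣ J ∣ + t ≤ r) →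
    ThreeSeparating X
  ThreeSeparating-from-bounds s t s<t+3 boundX bound∁X
    ((JX , JX⊆X , indJX , refl) , _) ((J∁X , J∁X⊆∁X , indJ∁X , refl) , _) rankE =
    x+y<e+3 (boundX JX JX⊆X indJX) (bound∁X rankE J∁X J∁X⊆∁X indJ∁X)
    where
    x+y<e+3 : ∀ {x y e} → x ≤ s → y + t ≤ e → x + y < e + 3
    x+y<e+3 {x} {y} {e} x≤s y+t≤e = +-cancelʳ-< t (x + y) (e + 3) (begin-strict
      x + y + t   ≡⟨ +-assoc x y t ⟩
      x + (y + t) ≤⟨ +-mono-≤ x≤s y+t≤e ⟩
      s + e       <⟨ +-monoˡ-< e s<t+3 ⟩
      t + 3 + e   ≡⟨ +-comm (t + 3) e ⟩
      e + (t + 3) ≡⟨ cong (e +_) (+-comm t 3) ⟩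
      e + (3 + t) ≡⟨ +-assoc e 3 t ⟨
      e + 3 + t   ∎)
      where open ≤-Reasoning

  no-large-3-separating : InternallyFourConnected M → 4 ≤ ∣ X ∣ → 4 ≤ ∣ ∁ X ∣ → ¬ ThreeSeparating X
  no-large-3-separating {X} (_ , small-side) 4≤∣X∣ 4≤∣∁X∣ sepX =
    rank-exists X λ (rX , rankX) → rank-exists (∁ X) λ (rY , rank∁X) → rank-exists ⊤ λ (rE , rankE) →
    [ too-large 4≤∣X∣ , too-large 4≤∣∁X∣ ]′ (small-side X
      (≤-trans (n≤1+n 3) 4≤∣X∣ , ≤-trans (n≤1+n 3) 4≤∣∁X∣ ,
       rX , rY , rE , rankX , rank∁X , rankE , sepX rankX rank∁X rankE))
    where
    too-large : ∀ {Y} → 4 ≤ ∣ Y ∣ → ¬ TriangleOrTriad M Y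
    too-large 4≤∣Y∣ (inj₁ (_ , ∣Y∣≡3)) = <-irrefl (sym ∣Y∣≡3) 4≤∣Y∣
    too-large 4≤∣Y∣ (inj₂ (_ , ∣Y∣≡3)) = <-irrefl (sym ∣Y∣≡3) 4≤∣Y∣

  triangle-pair-not-3-separating : {T₁ T₂ : Subset m} {w : Fin m} →
    InternallyFourConnected M → 10 ≤ m → Triangle M T₁ → Triangle M T₂ → w ∈ T₂ → w ∉ T₁ →
    ¬ ThreeSeparating (T₁ ∪ T₂)
  triangle-pair-not-3-separating {T₁} {T₂} {w} ifc 10≤m (_ , ∣T₁∣≡3) (_ , ∣T₂∣≡3) w∈T₂ w∉T₁ =
    no-large-3-separating ifc 4≤∣T₁∪T₂∣ 4≤∣∁T₁∪T₂∣
    where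
    4≤∣T₁∪T₂∣ : 4 ≤ ∣ T₁ ∪ T₂ ∣
    4≤∣T₁∪T₂∣ = subst (_< ∣ T₁ ∪ T₂ ∣) ∣T₁∣≡3
      (p⊂q⇒∣p∣<∣q∣ (p⊆p∪q T₂ , w , q⊆p∪q T₁ T₂ w∈T₂ , w∉T₁))
    ∣T₁∪T₂∣≤6 : ∣ T₁ ∪ T₂ ∣ ≤ 6
    ∣T₁∪T₂∣≤6 = subst (∣ T₁ ∪ T₂ ∣ ≤_) (cong₂ _+_ ∣T₁∣≡3 ∣T₂∣≡3) (∣p∪q∣≤∣p∣+∣q∣ T₁ T₂)
    4≤∣∁T₁∪T₂∣ : 4 ≤ ∣ ∁ (T₁ ∪ T₂) ∣
    4≤∣∁T₁∪T₂∣ = subst (4 ≤_) (sym (∣∁p∣≡n∸∣p∣ (T₁ ∪ T₂)))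
      (≤-trans (∸-monoˡ-≤ 6 10≤m) (∸-monoʳ-≤ m ∣T₁∪T₂∣≤6))

  triangles-sharing-two-elements-≡ : {C₁ C₂ : Subset m} {u v : Fin m} →
    InternallyFourConnected M → 10 ≤ m → Triangle M C₁ → Triangle M C₂ →
    u ≢ v → u ∈ C₁ → v ∈ C₁ → u ∈ C₂ → v ∈ C₂ → C₁ ≡ C₂
  triangles-sharing-two-elements-≡ {C₁} {C₂} {u} {v} ifc 10≤m t₁@(circuit₁ , ∣C₁∣≡3) t₂@(circuit₂ , ∣C₂∣≡3)
    u≢v u∈C₁ v∈C₁ u∈C₂ v∈C₂ with ⊆-or-∃∉ C₂ C₁
  ... | inj₁ C₂⊆C₁ = sym (CircuitOf-⊆⇒≡ circuit₂ circuit₁ C₂⊆C₁)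
  ... | inj₂ (w , w∈C₂ , w∉C₁) = ⊥-elim (triangle-pair-not-3-separating ifc 10≤m t₁ t₂ w∈C₂ w∉C₁
        (ThreeSeparating-from-bounds 2 0 ≤-refl rank≤2
          λ (_ , maximal) J _ indJ → subst (_≤ _) (sym (+-identityʳ _)) (maximal J (λ _ → ∈⊤) indJ)))
    where
    UV : Subset m
    UV = ⁅ u ⁆ ∪ ⁅ v ⁆
    ∣UV∣≡2 : ∣ UV ∣ ≡ 2
    ∣UV∣≡2 = trans (x∉p⇒∣p∪⁅x⁆∣≡1+∣p∣ ⁅ u ⁆ (x≢y⇒x∉⁅y⁆ (u≢v ∘ sym))) (cong suc (∣⁅x⁆∣≡1 u))
    UV⊆ : ∀ {C} → u ∈ C → v ∈ C → UV ⊆ C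
    UV⊆ u∈C v∈C = p⊆q∧x∈q⇒p∪⁅x⁆⊆q (x∈p⇒⁅x⁆⊆p u∈C) v∈C
    indUV : Indep M UV
    indUV = CircuitOf-⊂-indep circuit₁ (UV⊆ u∈C₁ v∈C₁)
      (subst (_< ∣ C₁ ∣) (sym ∣UV∣≡2) (≤-reflexive (sym ∣C₁∣≡3)))
    rank≤2 : ∀ J → J ⊆ C₁ ∪ C₂ → Indep M J → ∣ J ∣ ≤ 2
    rank≤2 J J⊆C₁∪C₂ indJ with ∣ J ∣ ≤? 2
    ... | yes ∣J∣≤2 = ∣J∣≤2
    ... | no  ∣J∣≰2 with augment M UV J indUV indJ (subst (_< ∣ J ∣) (sym ∣UV∣≡2) (≰⇒> ∣J∣≰2))
    ... | e , e∈J , e∉UV , indUVe =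
      ⊥-elim ([ dependent u∈C₁ v∈C₁ t₁ , dependent u∈C₂ v∈C₂ t₂ ]′ (x∈p∪q⁻ _ _ (J⊆C₁∪C₂ e∈J)))
      where
      dependent : ∀ {C} → u ∈ C → v ∈ C → Triangle M C → e ∉ C
      dependent u∈C v∈C (circuit , ∣C∣≡3) e∈C = circuit-⊆-dep circuit (p⊆q∧x∈q⇒p∪⁅x⁆⊆q (UV⊆ u∈C v∈C) e∈C)
        (≤-reflexive (trans ∣C∣≡3 (sym (trans (x∉p⇒∣p∪⁅x⁆∣≡1+∣p∣ UV e∉UV) (cong suc ∣UV∣≡2))))) indUVe

  -- If a basis J ∪ {e} of size r(M) existed, one of D₁, D₂ would avoid it.
  two-cocircuits-⇒-∁-rank-drop : {D₁ D₂ X J : Subset m} {r : ℕ} {f : Fin m} →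
    Cocircuit M D₁ → Cocircuit M D₂ → D₁ ⊆ X → D₂ ⊆ X → f ∈ D₂ → f ∉ D₁ →
    IsRank M ⊤ r → J ⊆ ∁ X → Indep M J → ∣ J ∣ + 2 ≤ r
  two-cocircuits-⇒-∁-rank-drop {D₁} {D₂} {X} {J} {r} {f} co₁ co₂@(_ , min₂) D₁⊆X D₂⊆X f∈D₂ f∉D₁ rank J⊆∁X indJ
    with ∣ J ∣ + 2 ≤? r
  ... | yes ∣J∣+2≤r = ∣J∣+2≤r
  ... | no  ∣J∣+2≰r = ⊥-elim absurd
    where
    avoids : ∀ {D} → D ⊆ X → ∀ {x} → x ∈ D → x ∉ J
    avoids D⊆X x∈D x∈J = x∈∁p⇒x∉p (J⊆∁X x∈J) (D⊆X x∈D)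
    avoids-∪ : ∀ {D e} → D ⊆ X → e ∉ D → ∀ {x} → x ∈ D → x ∉ J ∪ ⁅ e ⁆
    avoids-∪ {e = e} D⊆X e∉D x∈D x∈J∪e =
      [ avoids D⊆X x∈D , (λ x∈⁅e⁆ → e∉D (subst (_∈ _) (x∈⁅y⁆⇒x≡y e x∈⁅e⁆) x∈D)) ]′ (x∈p∪q⁻ J ⁅ e ⁆ x∈J∪e)
    basis-∪ : ∀ {e} → e ∉ J → Indep M (J ∪ ⁅ e ⁆) → Basis M (J ∪ ⁅ e ⁆)
    basis-∪ e∉J indJe = rank-sized-indep-is-basis rank indJe (subst (r ≤_) (sym (x∉p⇒∣p∪⁅x⁆∣≡1+∣p∣ J e∉J))
      (≤-pred (subst (r <_) (+-comm ∣ J ∣ 2) (≰⇒> ∣J∣+2≰r))))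
    absurd : ⊥
    absurd with r ≤? ∣ J ∣
    ... | yes r≤∣J∣ = cocircuit-meets-basis co₁ (rank-sized-indep-is-basis rank indJ r≤∣J∣) (avoids D₁⊆X)
    ... | no r≰∣J∣ with min₂ (D₂ - f) (x∈p⇒p-x⊂p f∈D₂)
    ... | B , basisB , D₂-f⊆∁B
      with augment M J B indJ (proj₁ basisB) (<-≤-trans (≰⇒> r≰∣J∣) (basis-size≥rank rank basisB))
    ... | e , e∈B , e∉J , indJe with e ∈? D₂ | e ≟ᶠ f
    ... | no e∉D₂  | _        = cocircuit-meets-basis co₂ (basis-∪ e∉J indJe) (avoids-∪ D₂⊆X e∉D₂)
    ... | yes _    | yes refl = cocircuit-meets-basis co₁ (basis-∪ e∉J indJe) (avoids-∪ D₁⊆X f∉D₁)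
    ... | yes e∈D₂ | no e≢f   = x∈∁p⇒x∉p (D₂-f⊆∁B (x∈p∧x≢y⇒x∈p-y e∈D₂ e≢f)) e∈B

  cocircuits-on-triangle-pair-≡ : {T₁ T₂ D₁ D₂ : Subset m} {w : Fin m} →
    InternallyFourConnected M → 10 ≤ m → Triangle M T₁ → Triangle M T₂ → w ∈ T₂ → w ∉ T₁ →
    Cocircuit M D₁ → Cocircuit M D₂ → D₁ ⊆ T₁ ∪ T₂ → D₂ ⊆ T₁ ∪ T₂ → D₁ ≡ D₂
  cocircuits-on-triangle-pair-≡ {T₁} {T₂} {D₁} {D₂} ifc 10≤m t₁ t₂ w∈T₂ w∉T₁ co₁ co₂ D₁⊆ D₂⊆
    with ⊆-or-∃∉ D₂ D₁
  ... | inj₁ D₂⊆D₁ = sym (CircuitOf-⊆⇒≡ co₂ co₁ D₂⊆D₁)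
  ... | inj₂ (f , f∈D₂ , f∉D₁) = ⊥-elim (triangle-pair-not-3-separating ifc 10≤m t₁ t₂ w∈T₂ w∉T₁
        (ThreeSeparating-from-bounds 4 2 ≤-refl rank≤4
          (λ rank J → two-cocircuits-⇒-∁-rank-drop co₁ co₂ D₁⊆ D₂⊆ f∈D₂ f∉D₁ rank)))
    where
    rank≤4 : ∀ J → J ⊆ T₁ ∪ T₂ → Indep M J → ∣ J ∣ ≤ 4
    rank≤4 J J⊆T₁∪T₂ indJ = begin
      ∣ J ∣                     ≤⟨ p⊆q⇒∣p∣≤∣q∣ J⊆J∩T₁∪J∩T₂ ⟩
      ∣ J ∩ T₁ ∪ J ∩ T₂ ∣       ≤⟨ ∣p∪q∣≤∣p∣+∣q∣ (J ∩ T₁) (J ∩ T₂) ⟩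
      ∣ J ∩ T₁ ∣ + ∣ J ∩ T₂ ∣   ≤⟨ +-mono-≤ (indep-∩-triangle-≤2 t₁ indJ) (indep-∩-triangle-≤2 t₂ indJ) ⟩
      4                         ∎
      where
      open ≤-Reasoning
      J⊆J∩T₁∪J∩T₂ : J ⊆ J ∩ T₁ ∪ J ∩ T₂
      J⊆J∩T₁∪J∩T₂ x∈J =
        [ (λ x∈T₁ → p⊆p∪q _ (x∈p∩q⁺ (x∈J , x∈T₁))) , (λ x∈T₂ → q⊆p∪q _ _ (x∈p∩q⁺ (x∈J , x∈T₂))) ]′
          (x∈p∪q⁻ T₁ T₂ (J⊆T₁∪T₂ x∈J))

module _ {m : ℕ} (a b c : ℕ → Fin m) where

  private
    T : ℕ → Subset m
    T = Tri a b c

  Dco⊆Tri∪Tri : ∀ j → Dco a b c j ⊆ T j ∪ T (suc j)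
  Dco⊆Tri∪Tri j x∈Dⱼ with ∈set4⁻ x∈Dⱼ
  ... | inj₁ refl                 = p⊆p∪q _ set3∋₂
  ... | inj₂ (inj₁ refl)          = p⊆p∪q _ set3∋₃
  ... | inj₂ (inj₂ (inj₁ refl))   = q⊆p∪q _ _ set3∋₁
  ... | inj₂ (inj₂ (inj₂ refl))   = q⊆p∪q _ _ set3∋₂

  set4⊆Tri∪Tri₀ : ∀ {n x} → x ≡ a n ⊎ x ≡ b n → set4 x (c n) (a 0) (b 0) ⊆ T n ∪ T 0
  set4⊆Tri∪Tri₀ x∈Tₙ y∈ with ∈set4⁻ y∈ | x∈Tₙ
  ... | inj₁ refl               | inj₁ refl = p⊆p∪q _ set3∋₁
  ... | inj₁ refl               | inj₂ refl = p⊆p∪q _ set3∋₂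
  ... | inj₂ (inj₁ refl)        | _         = p⊆p∪q _ set3∋₃
  ... | inj₂ (inj₂ (inj₁ refl)) | _         = q⊆p∪q _ _ set3∋₁
  ... | inj₂ (inj₂ (inj₂ refl)) | _         = q⊆p∪q _ _ set3∋₂

  ∈TriUpTo⁻ : ∀ N {x} → x ∈ TriUpTo a b c N → ∃ λ i → i ≤ N × x ∈ T i
  ∈TriUpTo⁻ zero    x∈T₀ = 0 , z≤n , x∈T₀
  ∈TriUpTo⁻ (suc N) x∈   with x∈p∪q⁻ (TriUpTo a b c N) (T (suc N)) x∈
  ... | inj₁ x∈UpToN = let i , i≤N , x∈Tᵢ = ∈TriUpTo⁻ N x∈UpToN in i , m≤n⇒m≤1+n i≤N , x∈Tᵢ
  ... | inj₂ x∈Tₙ₊₁  = suc N , ≤-refl , x∈Tₙ₊₁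

  Tri0⊆TriUpTo : ∀ N → T 0 ⊆ TriUpTo a b c N
  Tri0⊆TriUpTo zero    = λ x∈T₀ → x∈T₀
  Tri0⊆TriUpTo (suc N) = p⊆p∪q _ ∘ Tri0⊆TriUpTo N

module StringOfBowtiesProperties {m : ℕ} (M : Matroid m) (a b c : ℕ → Fin m) (n : ℕ)
  (string : StringOfBowties M a b c n) (T₀∩Tₙ≡∅ : Disjoint (Tri a b c 0) (Tri a b c n)) where

  private
    variable
      i j : ℕ
      z : Fin m
    T : ℕ → Subset m
    T = Tri a b c

    a-injective : i ≤ n → j ≤ n → a i ≡ a j → i ≡ j
    a-injective i≤n j≤n = proj₁ (proj₁ (proj₂ string) _ _ i≤n j≤n)
    b-injective : i ≤ n → j ≤ n → b i ≡ b j → i ≡ j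
    b-injective i≤n j≤n = proj₁ (proj₂ (proj₁ (proj₂ string) _ _ i≤n j≤n))
    c-injective : i ≤ n → j ≤ n → c i ≡ c j → i ≡ j
    c-injective i≤n j≤n = proj₁ (proj₂ (proj₂ (proj₁ (proj₂ string) _ _ i≤n j≤n)))
    a≢b : i ≤ n → j ≤ n → a i ≢ b j
    a≢b i≤n j≤n = proj₁ (proj₂ (proj₂ (proj₂ (proj₁ (proj₂ string) _ _ i≤n j≤n))))
    b≢c : i ≤ n → j ≤ n → b i ≢ c j
    b≢c i≤n j≤n = proj₁ (proj₂ (proj₂ (proj₂ (proj₂ (proj₁ (proj₂ string) _ _ i≤n j≤n)))))
    a≡c⇒ends : i ≤ n → j ≤ n → a i ≡ c j → i ≡ 0 × j ≡ n
    a≡c⇒ends i≤n j≤n = proj₂ (proj₂ (proj₂ (proj₂ (proj₂ (proj₁ (proj₂ string) _ _ i≤n j≤n)))))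

    a≡c-disjoint : i ≤ n → j ≤ n → a i ≡ c j → z ∈ T i → z ∉ T j
    a≡c-disjoint {i} {j} {z} i≤n j≤n aᵢ≡cⱼ z∈Tᵢ z∈Tⱼ =
      let i≡0 , j≡n = a≡c⇒ends i≤n j≤n aᵢ≡cⱼ
      in Disjoint⇒∉ T₀∩Tₙ≡∅ (subst (λ l → z ∈ T l) i≡0 z∈Tᵢ) (subst (λ l → z ∈ T l) j≡n z∈Tⱼ)

  triangle : i ≤ n → Triangle M (T i)
  triangle = proj₁ (proj₂ (proj₂ string)) _

  cocircuit : i < n → Cocircuit M (Dco a b c i)
  cocircuit = proj₂ (proj₂ (proj₂ string)) _

  same-index : i ≤ n → j ≤ n → z ∈ T i → z ∈ T j → i ≡ j
  same-index i≤n j≤n z∈Tᵢ z∈Tⱼ with ∈set3⁻ z∈Tᵢ | ∈set3⁻ z∈Tⱼ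
  ... | inj₁ refl        | inj₁ aᵢ≡aⱼ        = a-injective i≤n j≤n aᵢ≡aⱼ
  ... | inj₁ refl        | inj₂ (inj₁ aᵢ≡bⱼ) = ⊥-elim (a≢b i≤n j≤n aᵢ≡bⱼ)
  ... | inj₁ refl        | inj₂ (inj₂ aᵢ≡cⱼ) = ⊥-elim (a≡c-disjoint i≤n j≤n aᵢ≡cⱼ z∈Tᵢ z∈Tⱼ)
  ... | inj₂ (inj₁ refl) | inj₁ bᵢ≡aⱼ        = ⊥-elim (a≢b j≤n i≤n (sym bᵢ≡aⱼ))
  ... | inj₂ (inj₁ refl) | inj₂ (inj₁ bᵢ≡bⱼ) = b-injective i≤n j≤n bᵢ≡bⱼ
  ... | inj₂ (inj₁ refl) | inj₂ (inj₂ bᵢ≡cⱼ) = ⊥-elim (b≢c i≤n j≤n bᵢ≡cⱼ)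
  ... | inj₂ (inj₂ refl) | inj₁ cᵢ≡aⱼ        = ⊥-elim (a≡c-disjoint j≤n i≤n (sym cᵢ≡aⱼ) z∈Tⱼ z∈Tᵢ)
  ... | inj₂ (inj₂ refl) | inj₂ (inj₁ cᵢ≡bⱼ) = ⊥-elim (b≢c j≤n i≤n (sym cᵢ≡bⱼ))
  ... | inj₂ (inj₂ refl) | inj₂ (inj₂ cᵢ≡cⱼ) = c-injective i≤n j≤n cᵢ≡cⱼ

module BowtieExtension {m : ℕ} (M : Matroid m) (a b c : ℕ → Fin m) (n : ℕ) (D : Subset m)
  (ifc : InternallyFourConnected M) (10≤m : 10 ≤ m) (string : StringOfBowties M a b c n)
  (T₀∩Tₙ≡∅ : Disjoint (Tri a b c 0) (Tri a b c n))
  (bowtie : Bowtie M (Tri a b c n) (Tri a b c (suc n)) D)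
  (D≢Dₙ₋₁ : D ≢ Dco a b c (n ∸ 1))
  (cₙaₙ₊₁bₙ₊₁⊆D : set3 (c n) (a (suc n)) (b (suc n)) ⊆ D) where

  open MatroidProperties M
  open StringOfBowtiesProperties M a b c n string T₀∩Tₙ≡∅

  private
    variable
      i j : ℕ
    T : ℕ → Subset m
    T = Tri a b c
    Tₙ₊₁ : Subset m
    Tₙ₊₁ = T (suc n)
    cₙ₊₁ : Fin m
    cₙ₊₁ = c (suc n)

    triangleₙ₊₁ : Triangle M Tₙ₊₁
    triangleₙ₊₁ = proj₁ (proj₂ bowtie)
    Tₙ∩Tₙ₊₁≡∅ : Disjoint (T n) Tₙ₊₁
    Tₙ∩Tₙ₊₁≡∅ = proj₁ (proj₂ (proj₂ bowtie))
    D-cocircuit : Cocircuit M D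
    D-cocircuit = proj₁ (proj₂ (proj₂ (proj₂ bowtie)))
    D⊆Tₙ∪Tₙ₊₁ : D ⊆ T n ∪ Tₙ₊₁
    D⊆Tₙ∪Tₙ₊₁ = proj₂ (proj₂ (proj₂ (proj₂ (proj₂ bowtie))))

  Outcome-i : Set
  Outcome-i = ∃ λ j → j + 2 ≤ n × Tₙ₊₁ ≡ T j

  Outcome-ii : Set
  Outcome-ii = Tₙ₊₁ ∩ TriUpTo a b c n ≡ Tₙ₊₁ ∩ T 0 × Tₙ₊₁ ∩ T 0 ≡ ⁅ a 0 ⁆ × a 0 ≡ cₙ₊₁

  Meets : Set
  Meets = ∃ λ i → i ≤ n × Nonempty (Tₙ₊₁ ∩ T i)

  Fresh : Set
  Fresh = ∀ {j} → j ≤ n → Tₙ₊₁ ≢ T j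

  Tₙ₊₁-meets⇒<n : x ∈ Tₙ₊₁ → x ∈ T i → i ≤ n → i < n
  Tₙ₊₁-meets⇒<n {x} x∈Tₙ₊₁ x∈Tᵢ i≤n =
    ≤∧≢⇒< i≤n λ i≡n → Disjoint⇒∉ Tₙ∩Tₙ₊₁≡∅ (subst (λ l → x ∈ T l) i≡n x∈Tᵢ) x∈Tₙ₊₁

  repeat-index-bound : j ≤ n → Tₙ₊₁ ≡ T j → j + 2 ≤ n
  repeat-index-bound {j} j≤n Tₙ₊₁≡Tⱼ with Tₙ₊₁-meets⇒<n (subst (c j ∈_) (sym Tₙ₊₁≡Tⱼ) set3∋₃) set3∋₃ j≤n
  ... | j<n with m≤n⇒m<n∨m≡n j<n
  ... | inj₁ j+1<n = subst (_≤ n) (+-comm 2 j) j+1<n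
  ... | inj₂ j+1≡n = ⊥-elim (D≢Dₙ₋₁ (trans D≡Dⱼ (cong (λ l → Dco a b c (l ∸ 1)) j+1≡n)))
    where
    D⊆Tⱼ∪Tₙ : D ⊆ T j ∪ T n
    D⊆Tⱼ∪Tₙ x∈D = [ q⊆p∪q _ _ , p⊆p∪q _ ∘ subst (_ ∈_) Tₙ₊₁≡Tⱼ ]′ (x∈p∪q⁻ _ _ (D⊆Tₙ∪Tₙ₊₁ x∈D))
    aₙ∉Tⱼ : a n ∉ T j
    aₙ∉Tⱼ aₙ∈Tⱼ = <⇒≢ j<n (same-index j≤n ≤-refl aₙ∈Tⱼ set3∋₁)
    D≡Dⱼ : D ≡ Dco a b c j
    D≡Dⱼ = cocircuits-on-triangle-pair-≡ ifc 10≤m (triangle j≤n) (triangle ≤-refl) set3∋₁ aₙ∉Tⱼ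
      D-cocircuit (cocircuit j<n) D⊆Tⱼ∪Tₙ (subst (λ l → Dco a b c j ⊆ T j ∪ T l) j+1≡n (Dco⊆Tri∪Tri a b c j))

  outcome-i-or-fresh : Outcome-i ⊎ Fresh
  outcome-i-or-fresh with anyUpTo? (λ j → ≡-dec _≟ᵇ_ Tₙ₊₁ (T j)) (suc n)
  ... | yes (j , s≤s j≤n , Tₙ₊₁≡Tⱼ) = inj₁ (j , repeat-index-bound j≤n Tₙ₊₁≡Tⱼ , Tₙ₊₁≡Tⱼ)
  ... | no  no-repeat              = inj₂ λ j≤n Tₙ₊₁≡Tⱼ → no-repeat (_ , s≤s j≤n , Tₙ₊₁≡Tⱼ)

  -- Orthogonality with D: any second element of Tᵢ ∩ D lies in Tₙ (impossible) or in Tₙ₊₁ (then Tᵢ = Tₙ₊₁).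
  D∩Tₙ₊₁-off-string : Fresh → x ∈ Tₙ₊₁ → x ∈ D → i ≤ n → x ∉ T i
  D∩Tₙ₊₁-off-string {x} {i} fresh x∈Tₙ₊₁ x∈D i≤n x∈Tᵢ =
    orthogonality (proj₁ (triangle i≤n)) D-cocircuit x∈Tᵢ x∈D only-x
    where
    only-x : ∀ {z} → z ∈ T i → z ∈ D → z ≡ x
    only-x {z} z∈Tᵢ z∈D with x∈p∪q⁻ _ _ (D⊆Tₙ∪Tₙ₊₁ z∈D)
    ... | inj₁ z∈Tₙ = ⊥-elim (Disjoint⇒∉ Tₙ∩Tₙ₊₁≡∅
          (subst (λ l → x ∈ T l) (same-index i≤n ≤-refl z∈Tᵢ z∈Tₙ) x∈Tᵢ) x∈Tₙ₊₁)
    ... | inj₂ z∈Tₙ₊₁ with z ≟ᶠ x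
    ... | yes z≡x = z≡x
    ... | no  z≢x = ⊥-elim (fresh i≤n (triangles-sharing-two-elements-≡ ifc 10≤m triangleₙ₊₁ (triangle i≤n)
          z≢x z∈Tₙ₊₁ x∈Tₙ₊₁ z∈Tᵢ x∈Tᵢ))

  string∩Tₙ₊₁⊆⁅cₙ₊₁⁆ : Fresh → i ≤ n → x ∈ Tₙ₊₁ → x ∈ T i → x ≡ cₙ₊₁
  string∩Tₙ₊₁⊆⁅cₙ₊₁⁆ fresh i≤n x∈Tₙ₊₁ x∈Tᵢ with ∈set3⁻ x∈Tₙ₊₁
  ... | inj₁ refl        = ⊥-elim (D∩Tₙ₊₁-off-string fresh x∈Tₙ₊₁ (cₙaₙ₊₁bₙ₊₁⊆D set3∋₂) i≤n x∈Tᵢ)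
  ... | inj₂ (inj₁ refl) = ⊥-elim (D∩Tₙ₊₁-off-string fresh x∈Tₙ₊₁ (cₙaₙ₊₁bₙ₊₁⊆D set3∋₃) i≤n x∈Tᵢ)
  ... | inj₂ (inj₂ x≡c)  = x≡c

  cₙ₊₁∉Dco : Fresh → j < n → cₙ₊₁ ∉ Dco a b c j
  cₙ₊₁∉Dco fresh j<n cₙ₊₁∈Dⱼ = orthogonality (proj₁ triangleₙ₊₁) (cocircuit j<n) set3∋₃ cₙ₊₁∈Dⱼ
    λ z∈Tₙ₊₁ z∈Dⱼ → [ string∩Tₙ₊₁⊆⁅cₙ₊₁⁆ fresh (<⇒≤ j<n) z∈Tₙ₊₁ , string∩Tₙ₊₁⊆⁅cₙ₊₁⁆ fresh j<n z∈Tₙ₊₁ ]′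
      (x∈p∪q⁻ _ _ (Dco⊆Tri∪Tri a b c _ z∈Dⱼ))

  cₙ₊₁∈string⇒≡a₀ : Fresh → ∀ i → i ≤ n → cₙ₊₁ ∈ T i → cₙ₊₁ ≡ a 0
  cₙ₊₁∈string⇒≡a₀ fresh i i≤n c∈Tᵢ with ∈set3⁻ c∈Tᵢ | Tₙ₊₁-meets⇒<n set3∋₃ c∈Tᵢ i≤n
  cₙ₊₁∈string⇒≡a₀ fresh zero    _   _ | inj₁ c≡a₀ | _ = c≡a₀
  cₙ₊₁∈string⇒≡a₀ fresh (suc i) i<n _ | inj₁ c≡aᵢ | _ =
    ⊥-elim (cₙ₊₁∉Dco fresh i<n (subst (_∈ Dco a b c i) (sym c≡aᵢ) set4∋₃))
  cₙ₊₁∈string⇒≡a₀ fresh i _ _ | inj₂ (inj₁ c≡bᵢ) | i<n =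
    ⊥-elim (cₙ₊₁∉Dco fresh i<n (subst (_∈ Dco a b c i) (sym c≡bᵢ) set4∋₁))
  cₙ₊₁∈string⇒≡a₀ fresh i _ _ | inj₂ (inj₂ c≡cᵢ) | i<n =
    ⊥-elim (cₙ₊₁∉Dco fresh i<n (subst (_∈ Dco a b c i) (sym c≡cᵢ) set4∋₂))

  meets⇒cₙ₊₁≡a₀ : Fresh → Meets → cₙ₊₁ ≡ a 0
  meets⇒cₙ₊₁≡a₀ fresh (i , i≤n , x , x∈Tₙ₊₁∩Tᵢ) =
    let x∈Tₙ₊₁ , x∈Tᵢ = x∈p∩q⁻ Tₙ₊₁ (T i) x∈Tₙ₊₁∩Tᵢ
    in cₙ₊₁∈string⇒≡a₀ fresh i i≤n (subst (_∈ T i) (string∩Tₙ₊₁⊆⁅cₙ₊₁⁆ fresh i≤n x∈Tₙ₊₁ x∈Tᵢ) x∈Tᵢ)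

  fresh⇒outcome-ii : Fresh → cₙ₊₁ ≡ a 0 → Outcome-ii
  fresh⇒outcome-ii fresh cₙ₊₁≡a₀ =
    ⊆-antisym ∩UpTo⊆∩T₀ ∩T₀⊆∩UpTo , ⊆-antisym ∩T₀⊆⁅a₀⁆ ⁅a₀⁆⊆∩T₀ , sym cₙ₊₁≡a₀
    where
    on-string⇒a₀ : ∀ {x i} → i ≤ n → x ∈ Tₙ₊₁ → x ∈ T i → x ≡ a 0
    on-string⇒a₀ i≤n x∈Tₙ₊₁ x∈Tᵢ = trans (string∩Tₙ₊₁⊆⁅cₙ₊₁⁆ fresh i≤n x∈Tₙ₊₁ x∈Tᵢ) cₙ₊₁≡a₀
    ∩UpTo⊆∩T₀ : Tₙ₊₁ ∩ TriUpTo a b c n ⊆ Tₙ₊₁ ∩ T 0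
    ∩UpTo⊆∩T₀ x∈ = let x∈Tₙ₊₁ , x∈UpTo = x∈p∩q⁻ _ _ x∈
                       i , i≤n , x∈Tᵢ  = ∈TriUpTo⁻ a b c n x∈UpTo
                   in x∈p∩q⁺ (x∈Tₙ₊₁ , subst (_∈ T 0) (sym (on-string⇒a₀ i≤n x∈Tₙ₊₁ x∈Tᵢ)) set3∋₁)
    ∩T₀⊆∩UpTo : Tₙ₊₁ ∩ T 0 ⊆ Tₙ₊₁ ∩ TriUpTo a b c n
    ∩T₀⊆∩UpTo x∈ = let x∈Tₙ₊₁ , x∈T₀ = x∈p∩q⁻ _ _ x∈ in x∈p∩q⁺ (x∈Tₙ₊₁ , Tri0⊆TriUpTo a b c n x∈T₀)
    ∩T₀⊆⁅a₀⁆ : Tₙ₊₁ ∩ T 0 ⊆ ⁅ a 0 ⁆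
    ∩T₀⊆⁅a₀⁆ x∈ = let x∈Tₙ₊₁ , x∈T₀ = x∈p∩q⁻ _ _ x∈
                  in subst (_∈ ⁅ a 0 ⁆) (sym (on-string⇒a₀ z≤n x∈Tₙ₊₁ x∈T₀)) (x∈⁅x⁆ (a 0))
    ⁅a₀⁆⊆∩T₀ : ⁅ a 0 ⁆ ⊆ Tₙ₊₁ ∩ T 0
    ⁅a₀⁆⊆∩T₀ = x∈p⇒⁅x⁆⊆p (x∈p∩q⁺ (subst (_∈ Tₙ₊₁) cₙ₊₁≡a₀ set3∋₃ , set3∋₁))

  outcome-i-or-ii : Meets → Outcome-i ⊎ Outcome-ii
  outcome-i-or-ii meets with outcome-i-or-fresh
  ... | inj₁ outcome-i = inj₁ outcome-i
  ... | inj₂ fresh     = inj₂ (fresh⇒outcome-ii fresh (meets⇒cₙ₊₁≡a₀ fresh meets))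

  cocircuit⇒outcome-i : Meets → x ≡ a n ⊎ x ≡ b n → Cocircuit M (set4 x (c n) (a 0) (b 0)) → Outcome-i
  cocircuit⇒outcome-i {x} meets x∈Tₙ co with outcome-i-or-fresh
  ... | inj₁ outcome-i = outcome-i
  ... | inj₂ fresh     = ⊥-elim (orthogonality (proj₁ triangleₙ₊₁) co set3∋₃
        (subst (_∈ set4 x (c n) (a 0) (b 0)) (sym (meets⇒cₙ₊₁≡a₀ fresh meets)) set4∋₃) only-cₙ₊₁)
    where
    only-cₙ₊₁ : ∀ {z} → z ∈ Tₙ₊₁ → z ∈ set4 x (c n) (a 0) (b 0) → z ≡ cₙ₊₁
    only-cₙ₊₁ z∈Tₙ₊₁ z∈C = [ string∩Tₙ₊₁⊆⁅cₙ₊₁⁆ fresh ≤-refl z∈Tₙ₊₁ , string∩Tₙ₊₁⊆⁅cₙ₊₁⁆ fresh z≤n z∈Tₙ₊₁ ]′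
      (x∈p∪q⁻ _ _ (set4⊆Tri∪Tri₀ a b c x∈Tₙ z∈C))

lemma5p4 : ∀ {m} (M : Matroid m) (a b c : ℕ → Fin m) (n : ℕ) (D : Subset m) →
    InternallyFourConnected M → 10 ≤ m →
    StringOfBowties M a b c n →
    Disjoint (Tri a b c 0) (Tri a b c n) →
    ¬ (a (suc n) ≡ b (suc n)) → ¬ (b (suc n) ≡ c (suc n)) → ¬ (a (suc n) ≡ c (suc n)) →
    Bowtie M (Tri a b c n) (Tri a b c (suc n)) D →
    ¬ (D ≡ Dco a b c (n ∸ 1)) →
    set3 (c n) (a (suc n)) (b (suc n)) ⊆ D →
    (∃ λ i → i ≤ n × Nonempty (Tri a b c (suc n) ∩ Tri a b c i)) →
    ((∃ λ j → j + 2 ≤ n × Tri a b c (suc n) ≡ Tri a b c j)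
      ⊎ (Tri a b c (suc n) ∩ TriUpTo a b c n ≡ Tri a b c (suc n) ∩ Tri a b c 0
         × Tri a b c (suc n) ∩ Tri a b c 0 ≡ ⁅ a 0 ⁆
         × a 0 ≡ c (suc n)))
    × (∀ x → (x ≡ a n ⊎ x ≡ b n) → Cocircuit M (set4 x (c n) (a 0) (b 0)) →
         ∃ λ j → j + 2 ≤ n × Tri a b c (suc n) ≡ Tri a b c j)
lemma5p4 M a b c n D ifc 10≤m string T₀∩Tₙ≡∅ _ _ _ bowtie D≢Dₙ₋₁ cₙaₙ₊₁bₙ₊₁⊆D meets =
  outcome-i-or-ii meets , λ _ → cocircuit⇒outcome-i meets
  where
  open BowtieExtension M a b c n D ifc 10≤m string T₀∩Tₙ≡∅ bowtie D≢Dₙ₋₁ cₙaₙ₊₁bₙ₊₁⊆D
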